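{- Let $m=m'm''$ with $\gcd(m',m'')=1$. Let $G=(V,E)$ be a finite graph and assign to each edge $e$ an integer $a_e$. Let $R_{G,\alpha}$, $R'_{G,\alpha'}$, $R''_{G,\alpha''}$ be the rings of splines on $G$ over $\mathbb{Z}/m\mathbb{Z}$, $\mathbb{Z}/m'\mathbb{Z}$, $\mathbb{Z}/m''\mathbb{Z}$ respectively, where in each case edge $e$ is labeled by the ideal generated by the reduction of $a_e$ (mod $m$, $m'$, $m''$ respectively). Then \[R_{G,\alpha}\cong R'_{G,\alpha'}\oplus R''_{G,\alpha''}.\]
   Context: For a finite graph $G=(V,E)$, a commutative ring $R$ with identity and an edge-labeling $\alpha:E\to\{\text{ideals of }R\}$, a spline is $f\in R^{|V|}$ with $f_u-f_v\in\alpha(uv)$ for every edge $uv$; $R_{G,\alpha}$ is the ring of splines (a subring of $R^{|V|}$). -}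

module Defs where

open import Level using (0ℓ)
open import Data.Nat as ℕ using (ℕ)
open import Data.Integer using (ℤ; +_; _+_; _*_; _-_; -_; 0ℤ; 1ℤ)
open import Data.Fin using (Fin)
open import Data.Product using (Σ; ∃₂; _,_; proj₁; proj₂)
open import Relation.Binary.PropositionalEquality
open import Algebra.Bundles.Raw using (RawRing)
open import Data.Integer.Solver using (module +-*-Solver)
open +-*-Solver

record Graph : Set where
  field
    nV  : ℕ
    nE  : ℕ
    src : Fin nE → Fin nV
    tgt : Fin nE → Fin nV
open Graph public

-- Z/mZ is modelled by ℤ with equality "congruent mod m".
_≡_[mod_] : ℤ → ℤ → ℕ → Set
x ≡ y [mod m ] = Σ ℤ λ k → x - y ≡ k * + m

-- x (an integer representative) lies in the ideal of Z/mZ generated by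
-- the reduction of a, i.e. x̄ = c̄ · ā for some c.
InIdeal : ℕ → ℤ → ℤ → Set
InIdeal m a x = ∃₂ λ c k → x ≡ c * a + k * + m

IsSpline : (m : ℕ) (G : Graph) (a : Fin (nE G) → ℤ) → (Fin (nV G) → ℤ) → Set
IsSpline m G a f = ∀ e → InIdeal m (a e) (f (src G e) - f (tgt G e))

Spline : (m : ℕ) (G : Graph) (a : Fin (nE G) → ℤ) → Set
Spline m G a = Σ (Fin (nV G) → ℤ) (IsSpline m G a)

_≈S_ : ∀ {m G a} → Spline m G a → Spline m G a → Set
_≈S_ {m} {G} (f , _) (g , _) = ∀ v → f v ≡ g v [mod m ]

private
  lemAdd : ∀ fu fv gu gv a m c k d l →
           fu - fv ≡ c * a + k * m → gu - gv ≡ d * a + l * m →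
           (fu + gu) - (fv + gv) ≡ (c + d) * a + (k + l) * m
  lemAdd fu fv gu gv a m c k d l p q = begin
      (fu + gu) - (fv + gv)
    ≡⟨ solve 4 (λ fu fv gu gv → (fu :+ gu) :- (fv :+ gv) := (fu :- fv) :+ (gu :- gv)) refl fu fv gu gv ⟩
      (fu - fv) + (gu - gv)
    ≡⟨ cong₂ _+_ p q ⟩
      (c * a + k * m) + (d * a + l * m)
    ≡⟨ solve 6 (λ a m c k d l → (c :* a :+ k :* m) :+ (d :* a :+ l :* m) := (c :+ d) :* a :+ (k :+ l) :* m) refl a m c k d l ⟩
      (c + d) * a + (k + l) * m ∎
    where open ≡-Reasoning

  lemMul : ∀ fu fv gu gv a m c k d l →
           fu - fv ≡ c * a + k * m → gu - gv ≡ d * a + l * m →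
           (fu * gu) - (fv * gv) ≡ (fu * d + gv * c) * a + (fu * l + gv * k) * m
  lemMul fu fv gu gv a m c k d l p q = begin
      (fu * gu) - (fv * gv)
    ≡⟨ solve 4 (λ fu fv gu gv → (fu :* gu) :- (fv :* gv) := fu :* (gu :- gv) :+ gv :* (fu :- fv)) refl fu fv gu gv ⟩
      fu * (gu - gv) + gv * (fu - fv)
    ≡⟨ cong₂ (λ x y → fu * x + gv * y) q p ⟩
      fu * (d * a + l * m) + gv * (c * a + k * m)
    ≡⟨ solve 8 (λ fu gv a m c k d l → fu :* (d :* a :+ l :* m) :+ gv :* (c :* a :+ k :* m) := (fu :* d :+ gv :* c) :* a :+ (fu :* l :+ gv :* k) :* m) refl fu gv a m c k d l ⟩
      (fu * d + gv * c) * a + (fu * l + gv * k) * m ∎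
    where open ≡-Reasoning

  lemNeg : ∀ fu fv a m c k → fu - fv ≡ c * a + k * m →
           (- fu) - (- fv) ≡ (- c) * a + (- k) * m
  lemNeg fu fv a m c k p = begin
      (- fu) - (- fv)
    ≡⟨ solve 2 (λ fu fv → (:- fu) :- (:- fv) := :- (fu :- fv)) refl fu fv ⟩
      - (fu - fv)
    ≡⟨ cong -_ p ⟩
      - (c * a + k * m)
    ≡⟨ solve 4 (λ a m c k → :- (c :* a :+ k :* m) := (:- c) :* a :+ (:- k) :* m) refl a m c k ⟩
      (- c) * a + (- k) * m ∎
    where open ≡-Reasoning

  lemConst : ∀ x a m → x - x ≡ 0ℤ * a + 0ℤ * m
  lemConst x a m = solve 3 (λ x a m → x :- x := con 0ℤ :* a :+ con 0ℤ :* m) refl x a m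

module _ {m : ℕ} {G : Graph} {a : Fin (nE G) → ℤ} where
  _+S_ : Spline m G a → Spline m G a → Spline m G a
  (f , sf) +S (g , sg) = (λ v → f v + g v) , λ e →
    let (c , k , p) = sf e ; (d , l , q) = sg e in
    c + d , k + l , lemAdd (f (src G e)) (f (tgt G e)) (g (src G e)) (g (tgt G e)) (a e) (+ m) c k d l p q

  _*S_ : Spline m G a → Spline m G a → Spline m G a
  (f , sf) *S (g , sg) = (λ v → f v * g v) , λ e →
    let (c , k , p) = sf e ; (d , l , q) = sg e in
    f (src G e) * d + g (tgt G e) * c , f (src G e) * l + g (tgt G e) * k , lemMul (f (src G e)) (f (tgt G e)) (g (src G e)) (g (tgt G e)) (a e) (+ m) c k d l p q

  -S_ : Spline m G a → Spline m G a
  -S (f , sf) = (λ v → - f v) , λ e →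
    let (c , k , p) = sf e in - c , - k , lemNeg (f (src G e)) (f (tgt G e)) (a e) (+ m) c k p

  constS : ℤ → Spline m G a
  constS x = (λ _ → x) , λ e → 0ℤ , 0ℤ , lemConst x (a e) (+ m)

splineRing : (m : ℕ) (G : Graph) (a : Fin (nE G) → ℤ) → RawRing 0ℓ 0ℓ
splineRing m G a = record
  { Carrier = Spline m G a
  ; _≈_ = _≈S_
  ; _+_ = _+S_
  ; _*_ = _*S_
  ; -_ = -S_
  ; 0# = constS 0ℤ
  ; 1# = constS 1ℤ
  }

-- Since splines are represented by integer vectors,
-- the forward map is the identity on representatives; all the content lies
-- in the modular arithmetic, which is developed first:
--   * coprimality gives an integer Bézout identity U·p + V·q = 1;
--   * congruences and ideal membership modulo m descend to any divisor of m;
--   * x ≡ y modulo p and modulo q gives x ≡ y modulo pq (injectivity);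
--   * the CRT lift crt g h = g·(V·q) + h·(U·p) reduces to g modulo p and to
--     h modulo q, and it maps a pair of splines to a spline modulo pq, since
--     a combination of an ideal element mod p weighted by a multiple of q and
--     one mod q weighted by a multiple of p lies in the ideal mod pq
--     (surjectivity).
-- The ring operations on splines act by the same integer formulas in every
-- modulus, so the homomorphism laws hold by reflexivity of congruence.
module Submission where

open import Defs
open import Data.Nat using (ℕ; _*_)
open import Data.Nat.Coprimality using (Coprime)
open import Data.Integer using (ℤ)
open import Data.Fin using (Fin)
open import Data.Product using (Σ)
open import Algebra.Bundles.Raw using (RawRing)
open import Algebra.Construct.DirectProduct using (rawRing)
open import Algebra.Morphism.Structures using (module RingMorphisms)

import Data.Nat as ℕ
open import Level using (0ℓ)
open import Data.Nat.Coprimality using (coprime-Bézout)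
open import Data.Nat.Divisibility using (_∣_; divides; m∣m*n; n∣m*n)
open import Data.Nat.GCD using (module Bézout)
open import Data.Integer using (+_; _+_; _-_; -_; 0ℤ; 1ℤ) renaming (_*_ to _·_)
open import Data.Integer.Properties using (pos-+; pos-*; +-comm)
open import Data.Integer.Solver using (module +-*-Solver)
open import Data.Product using (∃₂; _,_; _×_)
open import Relation.Binary.PropositionalEquality
open +-*-Solver

nat-Bézout-in-ℤ : ∀ x y m n → 1 ℕ.+ y ℕ.* n ≡ x ℕ.* m →
                  + x · + m + (- + y) · + n ≡ 1ℤ
nat-Bézout-in-ℤ x y m n eq = begin
    + x · + m + (- + y) · + n
  ≡⟨ cong (_+ (- + y) · + n) (sym (pos-* x m)) ⟩
    + (x ℕ.* m) + (- + y) · + n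
  ≡⟨ cong (λ t → + t + (- + y) · + n) (sym eq) ⟩
    + (1 ℕ.+ y ℕ.* n) + (- + y) · + n
  ≡⟨ cong (_+ (- + y) · + n) (trans (pos-+ 1 (y ℕ.* n)) (cong (λ t → 1ℤ + t) (pos-* y n))) ⟩
    (1ℤ + + y · + n) + (- + y) · + n
  ≡⟨ solve 2 (λ y n → (con 1ℤ :+ y :* n) :+ (:- y) :* n := con 1ℤ) refl (+ y) (+ n) ⟩
    1ℤ ∎
  where open ≡-Reasoning

coprime⇒Bézoutℤ : ∀ p q → Coprime p q → ∃₂ λ U V → U · + p + V · + q ≡ 1ℤ
coprime⇒Bézoutℤ p q c with coprime-Bézout c
... | Bézout.+- x y eq = + x , - + y , nat-Bézout-in-ℤ x y p q eq
... | Bézout.-+ x y eq = - + x , + y , trans (+-comm ((- + x) · + p) (+ y · + q)) (nat-Bézout-in-ℤ y x q p eq)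

mod-refl : ∀ x m → x ≡ x [mod m ]
mod-refl x m = 0ℤ , solve 2 (λ x m → x :- x := con 0ℤ :* m) refl x (+ m)

mod-trans : ∀ {x y z m} → x ≡ y [mod m ] → y ≡ z [mod m ] → x ≡ z [mod m ]
mod-trans {x} {y} {z} {m} (k , p) (l , q) = k + l , (begin
    x - z
  ≡⟨ solve 3 (λ x y z → x :- z := (x :- y) :+ (y :- z)) refl x y z ⟩
    (x - y) + (y - z)
  ≡⟨ cong₂ _+_ p q ⟩
    k · + m + l · + m
  ≡⟨ solve 3 (λ k l m → k :* m :+ l :* m := (k :+ l) :* m) refl k l (+ m) ⟩
    (k + l) · + m ∎)
  where open ≡-Reasoning

∣⇒multiple : ∀ {n m} → n ∣ m → ∀ k → Σ ℤ λ j → k · + m ≡ j · + n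
∣⇒multiple {n} (divides q refl) k = k · + q , (begin
    k · + (q ℕ.* n)
  ≡⟨ cong (k ·_) (pos-* q n) ⟩
    k · (+ q · + n)
  ≡⟨ solve 3 (λ k q n → k :* (q :* n) := (k :* q) :* n) refl k (+ q) (+ n) ⟩
    (k · + q) · + n ∎)
  where open ≡-Reasoning

mod-weaken : ∀ {n m x y} → n ∣ m → x ≡ y [mod m ] → x ≡ y [mod n ]
mod-weaken n∣m (k , p) with ∣⇒multiple n∣m k
... | j , eq = j , trans p eq

ideal-weaken : ∀ {n m a x} → n ∣ m → InIdeal m a x → InIdeal n a x
ideal-weaken {a = a} n∣m (c , k , p) with ∣⇒multiple n∣m k
... | j , eq = c , j , trans p (cong (λ t → c · a + t) eq)

mod-combine : ∀ p q U V → U · + p + V · + q ≡ 1ℤ →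
              ∀ {x y} → x ≡ y [mod p ] → x ≡ y [mod q ] → x ≡ y [mod p * q ]
mod-combine p q U V bézout {x} {y} (k , kp) (l , lq) = U · l + V · k , (begin
    x - y
  ≡⟨ solve 2 (λ x y → x :- y := (x :- y) :* con 1ℤ) refl x y ⟩
    (x - y) · 1ℤ
  ≡⟨ cong ((x - y) ·_) (sym bézout) ⟩
    (x - y) · (U · + p + V · + q)
  ≡⟨ solve 5 (λ d U V p q → d :* (U :* p :+ V :* q) := d :* U :* p :+ d :* V :* q)
           refl (x - y) U V (+ p) (+ q) ⟩
    (x - y) · U · + p + (x - y) · V · + q
  ≡⟨ cong₂ (λ s t → s · U · + p + t · V · + q) lq kp ⟩
    l · + q · U · + p + k · + p · V · + q
  ≡⟨ solve 6 (λ k l U V p q → l :* q :* U :* p :+ k :* p :* V :* q := (U :* l :+ V :* k) :* (p :* q))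
           refl k l U V (+ p) (+ q) ⟩
    (U · l + V · k) · (+ p · + q)
  ≡⟨ cong ((U · l + V · k) ·_) (sym (pos-* p q)) ⟩
    (U · l + V · k) · + (p * q) ∎)
  where open ≡-Reasoning

-- If U·p + V·q = 1 then V·q ≡ 1 and U·p ≡ 0 modulo p, so the combination
-- g·(V·q) + h·(U·p) reduces to g modulo p.
bézout-combination-mod : ∀ p q U V → U · + p + V · + q ≡ 1ℤ →
                         ∀ (g h : ℤ) → (g · (V · + q) + h · (U · + p)) ≡ g [mod p ]
bézout-combination-mod p q U V bézout g h = (h - g) · U , (begin
    g · (V · + q) + h · (U · + p) - g
  ≡⟨ solve 6 (λ g h U V p q → g :* (V :* q) :+ h :* (U :* p) :- g
                                := g :* ((U :* p :+ V :* q) :- con 1ℤ) :+ (h :- g) :* U :* p)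
           refl g h U V (+ p) (+ q) ⟩
    g · ((U · + p + V · + q) - 1ℤ) + (h - g) · U · + p
  ≡⟨ cong (λ t → g · (t - 1ℤ) + (h - g) · U · + p) bézout ⟩
    g · (1ℤ - 1ℤ) + (h - g) · U · + p
  ≡⟨ solve 4 (λ g h U p → g :* (con 1ℤ :- con 1ℤ) :+ (h :- g) :* U :* p := (h :- g) :* U :* p)
           refl g h U (+ p) ⟩
    (h - g) · U · + p ∎)
  where open ≡-Reasoning

ideal-combine : ∀ p q a {x y} → InIdeal p a x → InIdeal q a y →
                ∀ s t → InIdeal (p * q) a (s · + q · x + t · + p · y)
ideal-combine p q a {x} {y} (c , k , xp) (d , l , yq) s t =
  s · + q · c + t · + p · d , s · k + t · l , (begin
    s · + q · x + t · + p · y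
  ≡⟨ cong₂ (λ u w → s · + q · u + t · + p · w) xp yq ⟩
    s · + q · (c · a + k · + p) + t · + p · (d · a + l · + q)
  ≡⟨ solve 9 (λ s t c d k l a p q →
                s :* q :* (c :* a :+ k :* p) :+ t :* p :* (d :* a :+ l :* q)
                := (s :* q :* c :+ t :* p :* d) :* a :+ (s :* k :+ t :* l) :* (p :* q))
           refl s t c d k l a (+ p) (+ q) ⟩
    (s · + q · c + t · + p · d) · a + (s · k + t · l) · (+ p · + q)
  ≡⟨ cong (λ u → (s · + q · c + t · + p · d) · a + (s · k + t · l) · u) (sym (pos-* p q)) ⟩
    (s · + q · c + t · + p · d) · a + (s · k + t · l) · + (p * q) ∎)
  where open ≡-Reasoning

module SplineCRT (p q : ℕ) (U V : ℤ) (bézout : U · + p + V · + q ≡ 1ℤ)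
                 (G : Graph) (a : Fin (nE G) → ℤ) where

  R : RawRing 0ℓ 0ℓ
  R = splineRing (p * q) G a

  R′⊕R″ : RawRing 0ℓ 0ℓ
  R′⊕R″ = rawRing (splineRing p G a) (splineRing q G a)

  open RingMorphisms R R′⊕R″
  open RawRing R′⊕R″ using () renaming (_≈_ to _≈′_)

  reduce : Spline (p * q) G a → Spline p G a × Spline q G a
  reduce (f , isSpline) = (f , λ e → ideal-weaken (m∣m*n q) (isSpline e))
                        , (f , λ e → ideal-weaken (n∣m*n p) (isSpline e))

  -- Spline operations use the same integer formulas in every modulus, so
  -- each homomorphism law is an instance of this reflexivity.
  reduce-refl : ∀ s → reduce s ≈′ reduce s
  reduce-refl (f , _) = (λ v → mod-refl (f v) p) , (λ v → mod-refl (f v) q)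

  crt : ℤ → ℤ → ℤ
  crt g h = g · (V · + q) + h · (U · + p)

  crt-reduces₁ : ∀ g h → crt g h ≡ g [mod p ]
  crt-reduces₁ = bézout-combination-mod p q U V bézout

  crt-reduces₂ : ∀ g h → crt g h ≡ h [mod q ]
  crt-reduces₂ g h = subst (_≡ h [mod q ]) (+-comm (h · (U · + p)) (g · (V · + q)))
    (bézout-combination-mod q p V U (trans (+-comm (V · + q) (U · + p)) bézout) h g)

  -- The pointwise CRT lift of a pair of splines is a spline modulo pq: across
  -- an edge its difference is (V·q)·(g-difference) + (U·p)·(h-difference).
  lift : Spline p G a × Spline q G a → Spline (p * q) G a
  lift ((g , isSpline-g) , (h , isSpline-h)) = (λ v → crt (g v) (h v)) , λ e →
    let s = src G e ; t = tgt G e in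
    subst (InIdeal (p * q) (a e))
      (solve 8 (λ gs gt hs ht U V p q →
                  V :* q :* (gs :- gt) :+ U :* p :* (hs :- ht)
                  := (gs :* (V :* q) :+ hs :* (U :* p)) :- (gt :* (V :* q) :+ ht :* (U :* p)))
             refl (g s) (g t) (h s) (h t) U V (+ p) (+ q))
      (ideal-combine p q (a e) (isSpline-g e) (isSpline-h e) V U)

  reduce-cong : ∀ {x y} → x ≈S y → reduce x ≈′ reduce y
  reduce-cong {f , _} {g , _} f≈g =
      (λ v → mod-weaken {x = f v} {g v} (m∣m*n q) (f≈g v))
    , (λ v → mod-weaken {x = f v} {g v} (n∣m*n p) (f≈g v))

  reduce-injective : ∀ {x y} → reduce x ≈′ reduce y → x ≈S y
  reduce-injective {f , _} {g , _} (≈p , ≈q) v =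
    mod-combine p q U V bézout {f v} {g v} (≈p v) (≈q v)

  reduce-surjective : ∀ y → Σ (Spline (p * q) G a) λ x → ∀ {z} → z ≈S x → reduce z ≈′ y
  reduce-surjective y@((g , _) , (h , _)) = lift y , λ {(z , _)} z≈lift →
      (λ v → mod-trans {z v} (mod-weaken {x = z v} (m∣m*n q) (z≈lift v)) (crt-reduces₁ (g v) (h v)))
    , (λ v → mod-trans {z v} (mod-weaken {x = z v} (n∣m*n p) (z≈lift v)) (crt-reduces₂ (g v) (h v)))

  reduce-isRingIsomorphism : IsRingIsomorphism reduce
  reduce-isRingIsomorphism = record
    { isRingMonomorphism = record
      { isRingHomomorphism = record
        { isSemiringHomomorphism = record
          { isNearSemiringHomomorphism = record
            { +-isMonoidHomomorphism = record
              { isMagmaHomomorphism = record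
                { isRelHomomorphism = record { cong = λ {x} {y} → reduce-cong {x} {y} }
                ; homo = λ x y → reduce-refl (x +S y) }
              ; ε-homo = reduce-refl (constS 0ℤ) }
            ; *-homo = λ x y → reduce-refl (x *S y) }
          ; 1#-homo = reduce-refl (constS 1ℤ) }
        ; -‿homo = λ x → reduce-refl (-S x) }
      ; injective = λ {x} {y} → reduce-injective {x} {y} }
    ; surjective = reduce-surjective }

mainTheorem7 : (m′ m″ : ℕ) → Coprime m′ m″ →
    (G : Graph) (a : Fin (nE G) → ℤ) →
    Σ (RawRing.Carrier (splineRing (m′ * m″) G a) → RawRing.Carrier (rawRing (splineRing m′ G a) (splineRing m″ G a)))
      (RingMorphisms.IsRingIsomorphism (splineRing (m′ * m″) G a) (rawRing (splineRing m′ G a) (splineRing m″ G a)))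
mainTheorem7 m′ m″ coprime G a with coprime⇒Bézoutℤ m′ m″ coprime
... | U , V , bézout = reduce , reduce-isRingIsomorphism
  where open SplineCRT m′ m″ U V bézout G a
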